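{- Let $q\neq1$ be real and let $f_n(x,s,q)$ be defined by $f_0=1$, $f_1=x$ and $f_n(x,s,q)=x f_{n-1}(x,s,q)+q^{n-1}s f_{n-2}(x,s,q)$ for $n\ge 2$. Then, as formal power series in $z$, $$\sum_{n\ge0}f_n(x,s,q)z^n=\sum_{k\ge0}\frac{q^{k^2}s^kz^{2k}}{(1-xz)(1-qxz)\cdots(1-q^kxz)}.$$ -}

module Defs where

open import Algebra.Bundles using (CommutativeRing)
open import Data.Nat as ℕ using (ℕ; zero; suc; _∸_)
open import Data.Vec using (Vec; []; _∷_; head)

module PowerSeries {c ℓ} (R : CommutativeRing c ℓ) where
  open CommutativeRing R

  FPS : Set c
  FPS = ℕ → Carrier

  pow : Carrier → ℕ → Carrier
  pow a zero = 1#
  pow a (suc n) = a * pow a n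

  sumBelow : ℕ → (ℕ → Carrier) → Carrier
  sumBelow zero f = 0#
  sumBelow (suc n) f = sumBelow n f + f n

  sumUpTo : ℕ → (ℕ → Carrier) → Carrier
  sumUpTo n f = sumBelow (suc n) f

  _·_ : FPS → FPS → FPS
  (a · b) n = sumUpTo n (λ i → a i * b (n ∸ i))

  zpow : ℕ → FPS
  zpow zero zero = 1#
  zpow zero (suc n) = 0#
  zpow (suc m) zero = 0#
  zpow (suc m) (suc n) = zpow m n

  scale : Carrier → FPS → FPS
  scale c a n = c * a n

  oneMinus : Carrier → FPS
  oneMinus c zero = 1#
  oneMinus c (suc zero) = - c
  oneMinus c (suc (suc n)) = 0#

  prodUpTo : ℕ → (ℕ → FPS) → FPS
  prodUpTo zero F = F 0
  prodUpTo (suc k) F = prodUpTo k F · F (suc k)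

  vget : ∀ {m} → Vec Carrier m → ℕ → Carrier
  vget [] _ = 0#
  vget (x ∷ v) zero = x
  vget (x ∷ v) (suc j) = vget v j

  -- multiplicative inverse of a power series a with constant term 1:
  -- b 0 = 1,  b (n+1) = - Σ_{j=0}^{n} a (j+1) * b (n-j).
  -- invRev a n = [b n , ... , b 0]
  invRev : FPS → (n : ℕ) → Vec Carrier (suc n)
  invRev a zero = 1# ∷ []
  invRev a (suc n) =
    (- sumUpTo n (λ j → a (suc j) * vget (invRev a n) j)) ∷ invRev a n

  inv : FPS → FPS
  inv a n = head (invRev a n)

  -- sum of a family of power series T k where T k has z-order ≥ k
  -- (coefficient of z^n is Σ_{k ≤ n} (T k) n)
  sumFamily : (ℕ → FPS) → FPS
  sumFamily T n = sumUpTo n (λ k → T k n)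

  f : Carrier → Carrier → Carrier → ℕ → Carrier
  f x s q zero = 1#
  f x s q (suc zero) = x
  f x s q (suc (suc n)) = x * f x s q (suc n) + pow q (suc n) * s * f x s q n

  lhsSeries : Carrier → Carrier → Carrier → FPS
  lhsSeries x s q n = f x s q n

  rhsTerm : Carrier → Carrier → Carrier → ℕ → FPS
  rhsTerm x s q k =
    scale (pow q (k ℕ.* k) * pow s k) (zpow (2 ℕ.* k))
      · inv (prodUpTo k (λ i → oneMinus (pow q i * x)))

  rhsSeries : Carrier → Carrier → Carrier → FPS
  rhsSeries x s q = sumFamily (rhsTerm x s q)

{-# OPTIONS --safe #-}
-- Write P k = (1 - xz)(1 - qxz)⋯(1 - q^k xz) and let G (k + 1) be the explicit inverse of
-- P k, whose coefficients are the complete homogeneous polynomials in x, qx, …, q^k x.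
-- They satisfy the q-Pascal rule G (k+1) t = x G (k+1) (t-1) + q^t G k t.  Shifting by
-- z^{2k} and weighting by q^{k²} s^k turns this into a recurrence between the k-th and
-- (k+1)-th summands of the right-hand side which, summed over k, is exactly the
-- recurrence defining f.  Hence both sides have the same coefficients.
module Submission where

open import Defs
open import Algebra.Bundles using (CommutativeRing)
open import Data.Nat as ℕ using (ℕ; zero; suc; _∸_; _<_; _≤_; s≤s)
import Data.Nat.Properties as ℕ
open import Data.Nat.Tactic.RingSolver using (solve-∀)
open import Data.Product using (_×_; _,_; proj₁; proj₂)
open import Relation.Binary.PropositionalEquality as ≡ using (_≡_)
open import Relation.Nullary using (¬_)
import Algebra.Properties.Semiring.Exp as Exp

suc-square : ∀ k → suc k ℕ.* suc k ≡ suc (2 ℕ.* k) ℕ.+ k ℕ.* k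
suc-square = solve-∀

module Series {c ℓ} (R : CommutativeRing c ℓ) where
  open CommutativeRing R hiding (zero)
  open PowerSeries R
  open import Relation.Binary.Reasoning.Setoid setoid
  open import Algebra.Solver.Ring.NaturalCoefficients.Default commutativeSemiring
  open Exp semiring using (_^_; ^-homo-*)
  open import Algebra.Properties.Group +-group using (inverseˡ-unique)

  pow≡^ : ∀ a n → pow a n ≡ a ^ n
  pow≡^ a zero = ≡.refl
  pow≡^ a (suc n) = ≡.cong (a *_) (pow≡^ a n)

  pow-+ : ∀ a m n → pow a (m ℕ.+ n) ≈ pow a m * pow a n
  pow-+ a m n rewrite pow≡^ a (m ℕ.+ n) | pow≡^ a m | pow≡^ a n = ^-homo-* a m n

  sumBelow-cong : ∀ n {f g : ℕ → Carrier} → (∀ i → i < n → f i ≈ g i) →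
                  sumBelow n f ≈ sumBelow n g
  sumBelow-cong zero f≈g = refl
  sumBelow-cong (suc n) f≈g =
    +-cong (sumBelow-cong n (λ i i<n → f≈g i (ℕ.m<n⇒m<1+n i<n))) (f≈g n (ℕ.n<1+n n))

  sumBelow-0 : ∀ n (f : ℕ → Carrier) → (∀ i → i < n → f i ≈ 0#) → sumBelow n f ≈ 0#
  sumBelow-0 n f f≈0 = trans (sumBelow-cong n f≈0) (sumBelow-const0 n)
    where
    sumBelow-const0 : ∀ n → sumBelow n (λ _ → 0#) ≈ 0#
    sumBelow-const0 zero = refl
    sumBelow-const0 (suc n) = trans (+-identityʳ _) (sumBelow-const0 n)

  sumBelow-last0 : ∀ n (f : ℕ → Carrier) → f n ≈ 0# → sumBelow (suc n) f ≈ sumBelow n f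
  sumBelow-last0 n f fn≈0 = trans (+-congˡ fn≈0) (+-identityʳ _)

  sumBelow-first : ∀ n (f : ℕ → Carrier) →
                   sumBelow (suc n) f ≈ f 0 + sumBelow n (λ i → f (suc i))
  sumBelow-first zero f = trans (+-identityˡ (f 0)) (sym (+-identityʳ (f 0)))
  sumBelow-first (suc n) f = trans (+-congʳ (sumBelow-first n f)) (+-assoc (f 0) _ _)

  sumBelow-+ : ∀ n (f g : ℕ → Carrier) →
               sumBelow n (λ i → f i + g i) ≈ sumBelow n f + sumBelow n g
  sumBelow-+ zero f g = sym (+-identityˡ 0#)
  sumBelow-+ (suc n) f g = trans (+-congʳ (sumBelow-+ n f g))
    (solve 4 (λ a b u v → (a :+ b) :+ (u :+ v) := (a :+ u) :+ (b :+ v)) refl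
       (sumBelow n f) (sumBelow n g) (f n) (g n))

  sumBelow-*ˡ : ∀ n a (f : ℕ → Carrier) → sumBelow n (λ i → a * f i) ≈ a * sumBelow n f
  sumBelow-*ˡ zero a f = sym (zeroʳ a)
  sumBelow-*ˡ (suc n) a f = trans (+-congʳ (sumBelow-*ˡ n a f)) (sym (distribˡ a _ _))

  one : FPS
  one = zpow 0

  shiftBy : ℕ → FPS → FPS
  shiftBy zero A n = A n
  shiftBy (suc m) A zero = 0#
  shiftBy (suc m) A (suc n) = shiftBy m A n

  shift : FPS → FPS
  shift = shiftBy 1

  shiftBy-below : ∀ m A n → n < m → shiftBy m A n ≡ 0#
  shiftBy-below (suc m) A zero _ = ≡.refl
  shiftBy-below (suc m) A (suc n) (s≤s n<m) = shiftBy-below m A n n<m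

  mulOnePlus : Carrier → FPS → FPS
  mulOnePlus d A i = A i + d * shift A i

  ·-cong : ∀ {A A′ B B′ : FPS} → (∀ i → A i ≈ A′ i) → (∀ i → B i ≈ B′ i) →
           ∀ n → (A · B) n ≈ (A′ · B′) n
  ·-cong A≈ B≈ n = sumBelow-cong (suc n) (λ i _ → *-cong (A≈ i) (B≈ (n ∸ i)))

  shift-·-suc : ∀ A B n → (shift A · B) (suc n) ≈ (A · B) n
  shift-·-suc A B n = trans (sumBelow-first (suc n) _) (trans (+-congʳ (zeroˡ _)) (+-identityˡ _))

  ·-shift-suc : ∀ A B n → (A · shift B) (suc n) ≈ (A · B) n
  ·-shift-suc A B n = trans
    (+-cong (sumBelow-cong (suc n) (λ { i (s≤s i≤n) →
              *-congˡ (reflexive (≡.cong (shift B) (ℕ.+-∸-assoc 1 i≤n))) }))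
            (trans (*-congˡ (reflexive (≡.cong (shift B) (ℕ.n∸n≡0 n)))) (zeroʳ _)))
    (+-identityʳ _)

  shift-· : ∀ A B n → (shift A · B) n ≈ (A · shift B) n
  shift-· A B zero = trans (trans (+-identityˡ _) (zeroˡ _)) (sym (trans (+-identityˡ _) (zeroʳ _)))
  shift-· A B (suc n) = trans (shift-·-suc A B n) (sym (·-shift-suc A B n))

  ·-identityˡ : ∀ B n → (one · B) n ≈ B n
  ·-identityˡ B n = trans (sumBelow-first n _)
    (trans (+-cong (*-identityˡ (B n)) (sumBelow-0 n _ (λ i _ → zeroˡ _))) (+-identityʳ _))

  ·-identityʳ : ∀ A n → (A · one) n ≈ A n
  ·-identityʳ A zero = trans (+-identityˡ _) (*-identityʳ _)
  ·-identityʳ A (suc n) = trans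
    (+-cong (sumBelow-0 (suc n) _ (λ { i (s≤s i≤n) →
               trans (*-congˡ (reflexive (≡.cong one (ℕ.+-∸-assoc 1 i≤n)))) (zeroʳ _) }))
            (trans (*-congˡ (reflexive (≡.cong one (ℕ.n∸n≡0 n)))) (*-identityʳ _)))
    (+-identityˡ _)

  scale-· : ∀ a A B n → (scale a A · B) n ≈ a * (A · B) n
  scale-· a A B n = trans (sumBelow-cong (suc n) (λ i _ → *-assoc a (A i) _))
                          (sumBelow-*ˡ (suc n) a _)

  zpow-· : ∀ m B n → (zpow m · B) n ≈ shiftBy m B n
  zpow-· zero B n = ·-identityˡ B n
  zpow-· (suc m) B zero = trans (+-identityˡ _) (zeroˡ _)
  zpow-· (suc m) B (suc n) =
    trans (·-cong {B = B} zpow-suc≈shift (λ _ → refl) (suc n))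
          (trans (shift-·-suc (zpow m) B n) (zpow-· m B n))
    where
    zpow-suc≈shift : ∀ i → zpow (suc m) i ≈ shift (zpow m) i
    zpow-suc≈shift zero = refl
    zpow-suc≈shift (suc i) = refl

  mulOnePlus-· : ∀ d A B n → (mulOnePlus d A · B) n ≈ (A · B) n + d * (shift A · B) n
  mulOnePlus-· d A B n = trans
    (sumBelow-cong (suc n) (λ i _ →
       solve 4 (λ a a′ b e → (a :+ e :* a′) :* b := a :* b :+ e :* (a′ :* b)) refl
         (A i) (shift A i) (B (n ∸ i)) d))
    (trans (sumBelow-+ (suc n) _ _) (+-congˡ (sumBelow-*ˡ (suc n) d _)))

  ·-mulOnePlus : ∀ d A B n → (A · mulOnePlus d B) n ≈ (A · B) n + d * (A · shift B) n
  ·-mulOnePlus d A B n = trans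
    (sumBelow-cong (suc n) (λ i _ →
       solve 4 (λ a b b′ e → a :* (b :+ e :* b′) := a :* b :+ e :* (a :* b′)) refl
         (A i) (B (n ∸ i)) (shift B (n ∸ i)) d))
    (trans (sumBelow-+ (suc n) _ _) (+-congˡ (sumBelow-*ˡ (suc n) d _)))

  mulOnePlus-swap : ∀ d A B n → (mulOnePlus d A · B) n ≈ (A · mulOnePlus d B) n
  mulOnePlus-swap d A B n = trans (mulOnePlus-· d A B n)
    (trans (+-congˡ (*-congˡ (shift-· A B n))) (sym (·-mulOnePlus d A B n)))

  ·-oneMinus : ∀ a A n → (A · oneMinus a) n ≈ mulOnePlus (- a) A n
  ·-oneMinus a A n = begin
    (A · oneMinus a) n                        ≈⟨ ·-cong (λ _ → refl) oneMinus≈ n ⟩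
    (A · mulOnePlus (- a) one) n              ≈⟨ ·-mulOnePlus (- a) A one n ⟩
    (A · one) n + - a * (A · shift one) n     ≈⟨ +-congˡ (*-congˡ (sym (shift-· A one n))) ⟩
    (A · one) n + - a * (shift A · one) n
      ≈⟨ +-cong (·-identityʳ A n) (*-congˡ (·-identityʳ (shift A) n)) ⟩
    mulOnePlus (- a) A n                      ∎
    where
    oneMinus≈ : ∀ i → oneMinus a i ≈ mulOnePlus (- a) one i
    oneMinus≈ zero = sym (trans (+-congˡ (zeroʳ _)) (+-identityʳ _))
    oneMinus≈ (suc zero) = sym (trans (+-identityˡ _) (*-identityʳ _))
    oneMinus≈ (suc (suc i)) = sym (trans (+-identityˡ _) (zeroʳ _))

  oneMinus-cancel : ∀ a A B B′ → (∀ m → mulOnePlus (- a) B m ≈ B′ m) →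
                    ∀ n → ((A · oneMinus a) · B) n ≈ (A · B′) n
  oneMinus-cancel a A B B′ B≈ n = begin
    ((A · oneMinus a) · B) n         ≈⟨ ·-cong {B = B} (·-oneMinus a A) (λ _ → refl) n ⟩
    (mulOnePlus (- a) A · B) n       ≈⟨ mulOnePlus-swap (- a) A B n ⟩
    (A · mulOnePlus (- a) B) n       ≈⟨ ·-cong (λ _ → refl) B≈ n ⟩
    (A · B′) n                       ∎

  inv-unique : ∀ a b → a 0 ≈ 1# → b 0 ≈ 1# → (∀ n → (a · b) (suc n) ≈ 0#) →
               ∀ n → inv a n ≈ b n
  inv-unique a b a₀≈1 b₀≈1 ab≈0 n = inv≈upTo n n ℕ.≤-refl
    where
    vget-invRev : ∀ n j → j ≤ n → vget (invRev a n) j ≡ inv a (n ∸ j)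
    vget-invRev zero zero _ = ≡.refl
    vget-invRev (suc n) zero _ = ≡.refl
    vget-invRev (suc n) (suc j) (s≤s j≤n) = vget-invRev n j j≤n

    b-suc : ∀ m → b (suc m) ≈ - sumUpTo m (λ j → a (suc j) * b (m ∸ j))
    b-suc m = inverseˡ-unique (b (suc m)) _ (begin
      b (suc m) + _              ≈⟨ +-congʳ (sym (trans (*-congʳ a₀≈1) (*-identityˡ _))) ⟩
      a 0 * b (suc m) + _        ≈⟨ sym (sumBelow-first (suc m) _) ⟩
      (a · b) (suc m)            ≈⟨ ab≈0 m ⟩
      0#                         ∎)

    inv≈upTo : ∀ n m → m ≤ n → inv a m ≈ b m
    inv≈upTo n zero _ = sym b₀≈1
    inv≈upTo (suc n) (suc m) (s≤s m≤n) = trans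
      (-‿cong (sumBelow-cong (suc m) (λ { j (s≤s j≤m) → *-congˡ (trans
         (reflexive (vget-invRev m j j≤m))
         (inv≈upTo n (m ∸ j) (ℕ.≤-trans (ℕ.m∸n≤m m j) m≤n))) })))
      (sym (b-suc m))

  shiftBy-recurrence : ∀ a r (A B : FPS) → (∀ t → A t ≈ a * shift A t + pow r t * B t) →
    ∀ m n → pow r m * shiftBy m A n ≈ a * (pow r m * shiftBy (suc m) A n) + pow r n * shiftBy m B n
  shiftBy-recurrence a r A B rec zero n = trans (*-identityˡ _)
    (trans (rec n) (+-congʳ (*-congˡ (sym (*-identityˡ _)))))
  shiftBy-recurrence a r A B rec (suc m) zero =
    solve 3 (λ a Q r → Q :* con 0 := a :* (Q :* con 0) :+ con 1 :* con 0) refl a (pow r (suc m)) r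
  shiftBy-recurrence a r A B rec (suc m) (suc n) =
    trans (*-assoc r (pow r m) _) (trans (*-congˡ (shiftBy-recurrence a r A B rec m n))
      (solve 6 (λ r a Q u P v → r :* (a :* (Q :* u) :+ P :* v) := a :* ((r :* Q) :* u) :+ (r :* P) :* v)
        refl r a (pow r m) (shiftBy (suc m) A n) (pow r n) (shiftBy m B n)))

  module Identity (x s q : Carrier) where
    xq : ℕ → Carrier
    xq i = pow q i * x

    P : ℕ → FPS
    P k = prodUpTo k (λ i → oneMinus (xq i))

    -- G k = 1/((1 - xz)(1 - qxz)⋯(1 - q^{k-1}xz)), by the recursion (1 - q^k xz) G (k+1) = G k
    G : ℕ → FPS
    G zero m = one m
    G (suc k) zero = 1#
    G (suc k) (suc m) = G k (suc m) + xq k * G (suc k) m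

    G-zero : ∀ k → G k 0 ≡ 1#
    G-zero zero = ≡.refl
    G-zero (suc k) = ≡.refl

    G-rec : ∀ k m → G (suc k) m ≈ G k m + xq k * shift (G (suc k)) m
    G-rec k zero = sym (trans (+-congˡ (zeroʳ _)) (trans (+-identityʳ _) (reflexive (G-zero k))))
    G-rec k (suc m) = refl

    G-cancel : ∀ k m → mulOnePlus (- xq k) (G (suc k)) m ≈ G k m
    G-cancel k m = begin
      G (suc k) m + - xq k * S               ≈⟨ +-congʳ (G-rec k m) ⟩
      (G k m + xq k * S) + - xq k * S        ≈⟨ +-assoc (G k m) _ _ ⟩
      G k m + (xq k * S + - xq k * S)        ≈⟨ +-congˡ (sym (distribʳ S (xq k) (- xq k))) ⟩
      G k m + (xq k + - xq k) * S            ≈⟨ +-congˡ (trans (*-congʳ (-‿inverseʳ (xq k))) (zeroˡ S)) ⟩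
      G k m + 0#                             ≈⟨ +-identityʳ (G k m) ⟩
      G k m                                  ∎
      where S = shift (G (suc k)) m

    P-zero : ∀ k → P k 0 ≈ 1#
    P-zero zero = refl
    P-zero (suc k) = trans (+-identityˡ _) (trans (*-identityʳ _) (P-zero k))

    P·G : ∀ k n → (P k · G (suc k)) n ≈ one n
    P·G zero n = begin
      (oneMinus (xq 0) · G 1) n
        ≈⟨ ·-cong {B = G 1} (λ i → sym (·-identityˡ (oneMinus (xq 0)) i)) (λ _ → refl) n ⟩
      ((one · oneMinus (xq 0)) · G 1) n ≈⟨ oneMinus-cancel (xq 0) one (G 1) (G 0) (G-cancel 0) n ⟩
      (one · one) n                     ≈⟨ ·-identityˡ one n ⟩
      one n                             ∎
    P·G (suc k) n = trans (oneMinus-cancel (xq (suc k)) (P k) (G (suc (suc k))) (G (suc k))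
                             (G-cancel (suc k)) n)
                          (P·G k n)

    inv-P : ∀ k n → inv (P k) n ≈ G (suc k) n
    inv-P k = inv-unique (P k) (G (suc k)) (P-zero k) (reflexive (G-zero (suc k)))
                         (λ n → P·G k (suc n))

    G-qPascal : ∀ k t → G (suc k) t ≈ x * shift (G (suc k)) t + pow q t * G k t
    G-qPascal k zero = sym (trans (+-cong (zeroʳ x) (trans (*-identityˡ _) (reflexive (G-zero k))))
                                  (+-identityˡ 1#))
    G-qPascal zero (suc m) = solve 3 (λ x Q g → con 0 :+ (con 1 :* x) :* g := x :* g :+ Q :* con 0)
      refl x (pow q (suc m)) (G 1 m)
    G-qPascal (suc k) (suc m) = begin
      (a + xq k * b) + xq (suc k) * d                 ≈⟨ +-congʳ (G-qPascal k (suc m)) ⟩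
      (x * b + pow q (suc m) * a) + xq (suc k) * d    ≈⟨ +-congˡ (*-congˡ (G-qPascal (suc k) m)) ⟩
      (x * b + pow q (suc m) * a) + xq (suc k) * (x * e + pow q m * b)
        ≈⟨ solve 7 (λ x q p Q a b e →
             (x :* b :+ (q :* Q) :* a) :+ ((q :* p) :* x) :* (x :* e :+ Q :* b)
             := x :* (b :+ ((q :* p) :* x) :* e) :+ (q :* Q) :* (a :+ (p :* x) :* b))
           refl x q (pow q k) (pow q m) a b e ⟩
      x * (b + xq (suc k) * e) + pow q (suc m) * (a + xq k * b)
                                                      ≈⟨ +-congʳ (*-congˡ (sym (G-rec (suc k) m))) ⟩
      x * d + pow q (suc m) * (a + xq k * b)          ∎
      where
      a = G k (suc m)
      b = G (suc k) m
      d = G (suc (suc k)) m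
      e = shift (G (suc (suc k))) m

    coeff : ℕ → Carrier
    coeff k = pow q (k ℕ.* k) * pow s k

    term : ℕ → FPS
    term k n = coeff k * shiftBy (2 ℕ.* k) (G (suc k)) n

    rhsTerm≈term : ∀ k n → rhsTerm x s q k n ≈ term k n
    rhsTerm≈term k n = trans (·-cong (λ _ → refl) (inv-P k) n)
      (trans (scale-· (coeff k) (zpow (2 ℕ.* k)) (G (suc k)) n)
             (*-congˡ (zpow-· (2 ℕ.* k) (G (suc k)) n)))

    term-zero : ∀ n → term 0 n ≈ pow x n
    term-zero n = trans (*-congʳ (*-identityˡ 1#)) (trans (*-identityˡ _) (G1≈pow n))
      where
      G1≈pow : ∀ n → G 1 n ≈ pow x n
      G1≈pow zero = refl
      G1≈pow (suc n) = trans (+-identityˡ _) (*-cong (*-identityˡ x) (G1≈pow n))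

    term-below : ∀ k n → n < 2 ℕ.* k → term k n ≈ 0#
    term-below k n n<2k = trans (*-congˡ (reflexive (shiftBy-below (2 ℕ.* k) _ n n<2k))) (zeroʳ _)

    term-diagonal : ∀ n → term (suc n) n ≈ 0#
    term-diagonal n = term-below (suc n) n (ℕ.m≤m+n (suc n) _)

    coeff-suc : ∀ k → coeff (suc k) ≈ pow q (suc (2 ℕ.* k)) * s * coeff k
    coeff-suc k = begin
      pow q (suc k ℕ.* suc k) * (s * pow s k)
        ≈⟨ *-congʳ (trans (reflexive (≡.cong (pow q) (suc-square k))) (pow-+ q (suc (2 ℕ.* k)) (k ℕ.* k))) ⟩
      (Q * pow q (k ℕ.* k)) * (s * pow s k)
        ≈⟨ solve 4 (λ Q p s u → (Q :* p) :* (s :* u) := Q :* s :* (p :* u)) refl Q (pow q (k ℕ.* k)) s (pow s k) ⟩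
      Q * s * coeff k ∎
      where Q = pow q (suc (2 ℕ.* k))

    term-rec : ∀ k n →
      term (suc k) (suc (suc n)) ≈ x * term (suc k) (suc n) + pow q (suc n) * s * term k n
    term-rec k n = begin
      coeff (suc k) * shiftBy (2 ℕ.* suc k) A (2 ℕ.+ n)
        ≈⟨ *-cong (coeff-suc k) (reflexive (shiftBy-2*suc A (suc n))) ⟩
      (q * Q₀ * s * C) * shiftBy (2 ℕ.* k) A n
        ≈⟨ solve 5 (λ q Q s C a → (q :* Q :* s :* C) :* a := (q :* s :* C) :* (Q :* a)) refl q Q₀ s C _ ⟩
      (q * s * C) * (Q₀ * shiftBy (2 ℕ.* k) A n)
        ≈⟨ *-congˡ (shiftBy-recurrence x q A (G (suc k)) (G-qPascal (suc k)) (2 ℕ.* k) n) ⟩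
      (q * s * C) * (x * (Q₀ * b) + pow q n * h)
        ≈⟨ solve 8 (λ q Q s C x b P h → (q :* s :* C) :* (x :* (Q :* b) :+ P :* h)
                                      := x :* ((q :* Q :* s :* C) :* b) :+ (q :* P) :* s :* (C :* h))
             refl q Q₀ s C x b (pow q n) h ⟩
      x * ((q * Q₀ * s * C) * b) + pow q (suc n) * s * term k n
        ≈⟨ +-congʳ (*-congˡ (*-cong (sym (coeff-suc k)) (reflexive (≡.sym (shiftBy-2*suc A n))))) ⟩
      x * term (suc k) (suc n) + pow q (suc n) * s * term k n ∎
      where
      A = G (suc (suc k))
      Q₀ = pow q (2 ℕ.* k)
      C = coeff k
      b = shiftBy (suc (2 ℕ.* k)) A n
      h = shiftBy (2 ℕ.* k) (G (suc k)) n
      shiftBy-2*suc : ∀ B n → shiftBy (2 ℕ.* suc k) B (suc n) ≡ shiftBy (suc (2 ℕ.* k)) B n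
      shiftBy-2*suc B n = ≡.cong (λ j → shiftBy j B (suc n)) (ℕ.*-suc 2 k)

    rhsCoeff : ℕ → Carrier
    rhsCoeff n = sumUpTo n (λ k → term k n)

    rhsCoeff-rec : ∀ n →
      rhsCoeff (suc (suc n)) ≈ x * rhsCoeff (suc n) + pow q (suc n) * s * rhsCoeff n
    rhsCoeff-rec n = begin
      rhsCoeff (suc (suc n))                          ≈⟨ sumBelow-first (suc (suc n)) _ ⟩
      term 0 (suc (suc n)) + sumBelow (suc (suc n)) (λ k → term (suc k) (suc (suc n)))
        ≈⟨ +-cong (term-zero (suc (suc n))) (sumBelow-cong (suc (suc n)) (λ k _ → term-rec k n)) ⟩
      pow x (suc (suc n)) + sumBelow (suc (suc n)) (λ k → x * term (suc k) (suc n) + Ps * term k n)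
        ≈⟨ +-congˡ (trans (sumBelow-+ (suc (suc n)) _ _)
                     (+-cong (sumBelow-*ˡ (suc (suc n)) x _) (sumBelow-*ˡ (suc (suc n)) Ps _))) ⟩
      x * pow x (suc n) + (x * Σ₁ + Ps * Σ₀)
        ≈⟨ +-congˡ (+-cong (*-congˡ (sumBelow-last0 (suc n) _ (term-diagonal (suc n))))
                            (*-congˡ (sumBelow-last0 (suc n) _ (term-diagonal n)))) ⟩
      x * pow x (suc n) + (x * Σ₁′ + Ps * rhsCoeff n)
        ≈⟨ solve 5 (λ x X S A B → x :* X :+ (x :* S :+ A :* B) := x :* (X :+ S) :+ A :* B) refl
             x (pow x (suc n)) Σ₁′ Ps (rhsCoeff n) ⟩
      x * (pow x (suc n) + Σ₁′) + Ps * rhsCoeff n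
        ≈⟨ +-congʳ (*-congˡ (sym (trans (sumBelow-first (suc n) _) (+-congʳ (term-zero (suc n)))))) ⟩
      x * rhsCoeff (suc n) + Ps * rhsCoeff n ∎
      where
      Ps = pow q (suc n) * s
      Σ₀ = sumBelow (suc (suc n)) (λ k → term k n)
      Σ₁ = sumBelow (suc (suc n)) (λ k → term (suc k) (suc n))
      Σ₁′ = sumBelow (suc n) (λ k → term (suc k) (suc n))

    rhsCoeff-zero : rhsCoeff 0 ≈ 1#
    rhsCoeff-zero = trans (+-identityˡ _) (term-zero 0)

    rhsCoeff-one : rhsCoeff 1 ≈ x
    rhsCoeff-one = trans (sumBelow-last0 1 (λ k → term k 1) (term-below 1 1 ℕ.≤-refl))
                         (trans (+-identityˡ _) (trans (term-zero 1) (*-identityʳ x)))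

    f-unique : (a : ℕ → Carrier) → a 0 ≈ 1# → a 1 ≈ x →
               (∀ n → a (suc (suc n)) ≈ x * a (suc n) + pow q (suc n) * s * a n) →
               ∀ n → f x s q n ≈ a n
    f-unique a a₀ a₁ a-rec n = proj₁ (agreeAt n)
      where
      agreeAt : ∀ n → f x s q n ≈ a n × f x s q (suc n) ≈ a (suc n)
      agreeAt zero = sym a₀ , sym a₁
      agreeAt (suc n) = proj₂ (agreeAt n) ,
        trans (+-cong (*-congˡ (proj₂ (agreeAt n))) (*-congˡ (proj₁ (agreeAt n)))) (sym (a-rec n))

    lhs≈rhs : ∀ n → lhsSeries x s q n ≈ rhsSeries x s q n
    lhs≈rhs n = trans (f-unique rhsCoeff rhsCoeff-zero rhsCoeff-one rhsCoeff-rec n)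
                      (sym (sumBelow-cong (suc n) (λ k _ → rhsTerm≈term k n)))

-- The identity holds for every q.
mainTheorem6 : ∀ {c ℓ} (R : CommutativeRing c ℓ) →
    let open CommutativeRing R in
    let open PowerSeries R in
    (x s q : Carrier) → ¬ (q ≈ 1#) →
    (n : ℕ) → lhsSeries x s q n ≈ rhsSeries x s q n
mainTheorem6 R x s q _ = Series.Identity.lhs≈rhs R x s q
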